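{- Let $G$ be a graph having a dominating induced matching and let $H$ be a homogeneous set in $G$. Then: (i) if $G[H]$ contains an edge then $N(H)$ is a stable set; (ii) if $|N(H)| \ge 2$ then $G[H]$ is either edgeless or a disjoint union of edges (every vertex of $H$ has exactly one neighbor in $H$); (iii) two vertices $x,y$ are true twins with at least two common neighbors in $G$ if and only if $xy \in E$ and $x,y \in H'$ for some homogeneous set $H'$ of $G$ with $|N(H')| \ge 2$.
   Context: A dominating induced matching of $G=(V,E)$ is a set $M\subseteq E$ such that distinct edges of $M$ are disjoint and joined by no edge of $G$, and every edge of $E\setminus M$ shares an endpoint with an edge of $M$. A set $H \subseteq V$ with $|H|\ge 2$ and $H \ne V$ is homogeneous if every vertex outside $H$ is adjacent to all vertices of $H$ or to none. $N(H)$ denotes the set of vertices outside $H$ having a neighbor in $H$. Distinct vertices $x,y$ are true twins if $N[x]=N[y]$ (closed neighborhoods). -}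

module Defs where

open import Data.Nat using (ℕ; suc; _≤_)
open import Data.Bool using (Bool; true; false; T; not; _∧_; _∨_)
open import Data.Fin using (Fin; zero; suc; _≟_)
open import Data.Fin.Subset using (Subset; _∈_; _∉_; ⊤; _∩_; ∣_∣)
open import Data.Vec using (tabulate; lookup)
open import Data.Product using (Σ; ∃; _×_; _,_)
open import Data.Sum using (_⊎_)
open import Relation.Binary.PropositionalEquality using (_≡_; _≢_)
open import Relation.Nullary using (¬_; ⌊_⌋)

record Graph (n : ℕ) : Set where
  field
    adj   : Fin n → Fin n → Bool
    sym   : ∀ u v → adj u v ≡ adj v u
    irrefl : ∀ u → adj u u ≡ false

open Graph public

module _ {n : ℕ} (G : Graph n) where

  Adj : Fin n → Fin n → Set
  Adj u v = T (adj G u v)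

  anyᵇ : ∀ {m} → (Fin m → Bool) → Bool
  anyᵇ {ℕ.zero}  f = false
  anyᵇ {suc m} f = f zero ∨ anyᵇ (λ i → f (suc i))

  nbhd : Fin n → Subset n
  nbhd x = tabulate (adj G x)

  closedNbhd : Fin n → Subset n
  closedNbhd x = tabulate (λ z → ⌊ z ≟ x ⌋ ∨ adj G x z)

  N : Subset n → Subset n
  N H = tabulate (λ v → not (lookup H v) ∧ anyᵇ (λ h → lookup H h ∧ adj G v h))

  Homogeneous : Subset n → Set
  Homogeneous H =
    2 ≤ ∣ H ∣ × H ≢ ⊤ ×
    (∀ v → v ∉ H → (∀ h → h ∈ H → Adj v h) ⊎ (∀ h → h ∈ H → ¬ Adj v h))

  Stable : Subset n → Set
  Stable S = ∀ u v → u ∈ S → v ∈ S → ¬ Adj u v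

  HasEdgeIn : Subset n → Set
  HasEdgeIn H = Σ (Fin n) λ u → Σ (Fin n) λ v → u ∈ H × v ∈ H × Adj u v

  Edgeless : Subset n → Set
  Edgeless H = ∀ u v → u ∈ H → v ∈ H → ¬ Adj u v

  DisjointUnionOfEdges : Subset n → Set
  DisjointUnionOfEdges H =
    ∀ u → u ∈ H → Σ (Fin n) λ v → v ∈ H × Adj u v ×
                     (∀ w → w ∈ H → Adj u w → w ≡ v)

  TrueTwins : Fin n → Fin n → Set
  TrueTwins x y = x ≢ y × closedNbhd x ≡ closedNbhd y

  -- An edge set is represented by a symmetric Boolean relation M;
  -- the edge {u,v} belongs to M iff T (M u v).
  -- Two (ordered representations of) edges denote the same edge
  SameEdge : Fin n → Fin n → Fin n → Fin n → Set
  SameEdge u v x y = (u ≡ x × v ≡ y) ⊎ (u ≡ y × v ≡ x)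

  record IsDIM (M : Fin n → Fin n → Bool) : Set where
    field
      symM     : ∀ u v → M u v ≡ M v u
      subsetE  : ∀ u v → T (M u v) → Adj u v
      disjoint : ∀ u v x y → T (M u v) → T (M x y) → ¬ SameEdge u v x y →
                 u ≢ x × u ≢ y × v ≢ x × v ≢ y
      induced  : ∀ u v x y → T (M u v) → T (M x y) → ¬ SameEdge u v x y →
                 ¬ Adj u x × ¬ Adj u y × ¬ Adj v x × ¬ Adj v y
      dominating : ∀ u v → Adj u v → ¬ T (M u v) →
                   Σ (Fin n) λ x → Σ (Fin n) λ y → T (M x y) ×
                     (u ≡ x ⊎ u ≡ y ⊎ v ≡ x ⊎ v ≡ y)

  HasDIM : Set
  HasDIM = Σ (Fin n → Fin n → Bool) IsDIM

module Submission where

-- Call a vertex covered if it lies on an edge of M.  Every edge has a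
-- covered endpoint (so uncovered vertices are pairwise non-adjacent), a
-- covered vertex has a unique M-partner, and a neighbour of an M-edge off
-- that edge is uncovered.  For a module H with |N(H)| ≥ 2, every edge hh′
-- of G[H] lies in M: an M-edge hy with y ≠ h′ would leave h′ and some
-- c ∈ N(H) ∖ {y} uncovered, yet c and h′ are adjacent.  Hence N(H) is
-- uncovered, so stable (i), and each vertex of H is matched inside H (ii).
-- For (iii), true twins x, y form the homogeneous set {x, y}, whose
-- neighbourhood contains their common neighbours; conversely, by (ii) an
-- edge xy in such an H′ is the only edge of G[H′] at x and at y, so x and
-- y agree, and N(H′) lies in their common neighbourhood.

open import Defs hiding (sym)
open import Data.Nat using (ℕ; suc; _≤_; s≤s; z≤n)
open import Data.Nat.Properties using (≤-trans)
open import Data.Bool using (Bool; true; false; T; not; _∧_; _∨_)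
open import Data.Bool.Properties using (T-≡; T-not-≡; T-∧; T-∨)
open import Data.Unit using (tt)
open import Data.Empty using (⊥-elim)
open import Data.Fin using (Fin; _≟_) renaming (zero to fzero; suc to fsuc)
open import Data.Fin.Properties using (any?; suc-injective)
open import Data.Fin.Subset
  using (Subset; _∈_; _∉_; _∩_; _∪_; _⊆_; ∣_∣; ⊤; ⁅_⁆; inside; outside)
open import Data.Fin.Subset.Properties
  using ( _∈?_; nonempty?; Empty-unique; ∣⊥∣≡0; ∈⊤; x∈⁅x⁆; x∈⁅y⁆⇒x≡y; ∣⁅x⁆∣≡1
        ; p⊆q⇒∣p∣≤∣q∣; x∈p∩q⁺; x∈p∩q⁻; x∈p∪q⁺; x∈p∪q⁻; x∈p∧x≢y⇒x∈p-y
        ; x∈p⇒∣p-x∣<∣p∣)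
open import Data.Vec using (_∷_; lookup; tabulate; here; there)
open import Data.Vec.Properties using ([]=⇒lookup; lookup⇒[]=; lookup∘tabulate; tabulate-cong)
open import Data.Product using (Σ; ∃; _×_; _,_; proj₁)
open import Data.Sum using (_⊎_; inj₁; inj₂; [_,_]′)
open import Function.Bundles using (_⇔_; mk⇔; Equivalence)
open import Relation.Binary.PropositionalEquality
  using (_≡_; _≢_; refl; sym; trans; cong; subst; module ≡-Reasoning)
open import Relation.Nullary using (¬_; Dec; yes; no; ⌊_⌋; _×-dec_)
open import Relation.Nullary.Decidable using (T?)

open Equivalence using (to; from)

∈⇒T : ∀ {n} {p : Subset n} {i} → i ∈ p → T (lookup p i)
∈⇒T m = from T-≡ ([]=⇒lookup m)

T⇒∈ : ∀ {n} {p : Subset n} {i} → T (lookup p i) → i ∈ p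
T⇒∈ {p = p} {i} t = lookup⇒[]= i p (to T-≡ t)

∉⇒T-not : ∀ {n} {p : Subset n} {i} → i ∉ p → T (not (lookup p i))
∉⇒T-not {p = p} {i} i∉p with lookup p i in e
... | true  = ⊥-elim (i∉p (T⇒∈ (subst T (sym e) tt)))
... | false = tt

T-not⇒∉ : ∀ {n} {p : Subset n} {i} → T (not (lookup p i)) → i ∉ p
T-not⇒∉ t i∈p = subst T (to T-not-≡ t) (∈⇒T i∈p)

∈-tabulate⁺ : ∀ {n} (f : Fin n → Bool) {i} → T (f i) → i ∈ tabulate f
∈-tabulate⁺ f {i} t = T⇒∈ (subst T (sym (lookup∘tabulate f i)) t)

∈-tabulate⁻ : ∀ {n} (f : Fin n → Bool) {i} → i ∈ tabulate f → T (f i)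
∈-tabulate⁻ f {i} m = subst T (lookup∘tabulate f i) (∈⇒T m)

member : ∀ {n} (p : Subset n) → 1 ≤ ∣ p ∣ → ∃ λ x → x ∈ p
member {n} p 1≤∣p∣ with nonempty? p
... | yes x∈p = x∈p
... | no empty
  with subst (1 ≤_) (∣⊥∣≡0 n) (subst (λ q → 1 ≤ ∣ q ∣) (Empty-unique empty) 1≤∣p∣)
...   | ()

two-members : ∀ {n} (p : Subset n) → 2 ≤ ∣ p ∣ →
              ∃ λ a → ∃ λ b → a ≢ b × a ∈ p × b ∈ p
two-members (inside ∷ p) (s≤s 1≤∣p∣) with member p 1≤∣p∣
... | x , x∈p = fzero , fsuc x , (λ ()) , here , there x∈p
two-members (outside ∷ p) 2≤∣p∣ with two-members p 2≤∣p∣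
... | a , b , a≢b , a∈p , b∈p =
  fsuc a , fsuc b , (λ e → a≢b (suc-injective e)) , there a∈p , there b∈p

member-avoiding : ∀ {n} (p : Subset n) → 2 ≤ ∣ p ∣ → ∀ y → ∃ λ c → c ∈ p × c ≢ y
member-avoiding p 2≤∣p∣ y with two-members p 2≤∣p∣
... | a , b , a≢b , a∈p , b∈p with a ≟ y
...   | yes refl = b , b∈p , (λ b≡a → a≢b (sym b≡a))
...   | no a≢y   = a , a∈p , a≢y

member⇒1≤∣p∣ : ∀ {n} {p : Subset n} {x} → x ∈ p → 1 ≤ ∣ p ∣
member⇒1≤∣p∣ {p = p} {x} x∈p =
  subst (_≤ ∣ p ∣) (∣⁅x⁆∣≡1 x) (p⊆q⇒∣p∣≤∣q∣ ⁅x⁆⊆p)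
  where
  ⁅x⁆⊆p : ⁅ x ⁆ ⊆ p
  ⁅x⁆⊆p m = subst (_∈ p) (sym (x∈⁅y⁆⇒x≡y x m)) x∈p

two-members⇒2≤∣p∣ : ∀ {n} {p : Subset n} {a b} → a ≢ b → a ∈ p → b ∈ p → 2 ≤ ∣ p ∣
two-members⇒2≤∣p∣ a≢b a∈p b∈p =
  ≤-trans (s≤s (member⇒1≤∣p∣ (x∈p∧x≢y⇒x∈p-y b∈p (λ b≡a → a≢b (sym b≡a)))))
          (x∈p⇒∣p-x∣<∣p∣ a∈p)

≟-refl : ∀ {n} (z : Fin n) → ⌊ z ≟ z ⌋ ≡ true
≟-refl z with z ≟ z
... | yes _   = refl
... | no z≢z = ⊥-elim (z≢z refl)

≟-distinct : ∀ {n} {z x : Fin n} → z ≢ x → ⌊ z ≟ x ⌋ ≡ false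
≟-distinct {z = z} {x} z≢x with z ≟ x
... | yes z≡x = ⊥-elim (z≢x z≡x)
... | no _    = refl

T-ext : ∀ {a b} → (T a → T b) → (T b → T a) → a ≡ b
T-ext {true}  {true}  _ _ = refl
T-ext {true}  {false} f _ = ⊥-elim (f tt)
T-ext {false} {true}  _ g = ⊥-elim (g tt)
T-ext {false} {false} _ _ = refl

module _ {n : ℕ} (G : Graph n) where

  adj-sym : ∀ {u v} → Adj G u v → Adj G v u
  adj-sym {u} {v} = subst T (Graph.sym G u v)

  adj⇒≢ : ∀ {u v} → Adj G u v → u ≢ v
  adj⇒≢ {u} a refl = subst T (irrefl G u) a

  anyᵇ⁺ : ∀ {m} (f : Fin m → Bool) i → T (f i) → T (anyᵇ G f)
  anyᵇ⁺ f fzero    t = from T-∨ (inj₁ t)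
  anyᵇ⁺ f (fsuc i) t = from T-∨ (inj₂ (anyᵇ⁺ (λ j → f (fsuc j)) i t))

  anyᵇ⁻ : ∀ {m} (f : Fin m → Bool) → T (anyᵇ G f) → ∃ λ i → T (f i)
  anyᵇ⁻ {suc m} f t with to T-∨ t
  ... | inj₁ t₀ = fzero , t₀
  ... | inj₂ ts with anyᵇ⁻ (λ j → f (fsuc j)) ts
  ...   | i , tᵢ = fsuc i , tᵢ

  nbhd⁺ : ∀ {x c} → Adj G x c → c ∈ nbhd G x
  nbhd⁺ = ∈-tabulate⁺ (adj G _)

  nbhd⁻ : ∀ {x c} → c ∈ nbhd G x → Adj G x c
  nbhd⁻ = ∈-tabulate⁻ (adj G _)

  CompleteTo : Fin n → Subset n → Set
  CompleteTo c H = ∀ h → h ∈ H → Adj G c h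

  IsModule : Subset n → Set
  IsModule H = ∀ v → v ∉ H → CompleteTo v H ⊎ (∀ h → h ∈ H → ¬ Adj G v h)

  N⁺ : ∀ {H c h} → c ∉ H → h ∈ H → Adj G c h → c ∈ N G H
  N⁺ {h = h} c∉H h∈H a =
    ∈-tabulate⁺ _ (from T-∧ (∉⇒T-not c∉H , anyᵇ⁺ _ h (from T-∧ (∈⇒T h∈H , a))))

  N-of-module : ∀ {H} → IsModule H → ∀ {c} → c ∈ N G H → c ∉ H × CompleteTo c H
  N-of-module module-H {c} c∈N with to T-∧ (∈-tabulate⁻ _ c∈N)
  ... | outside-c , some-nbr with anyᵇ⁻ _ some-nbr
  ...   | h , t with to T-∧ t | module-H c (T-not⇒∉ outside-c)
  ...     | _ , _   | inj₁ complete = T-not⇒∉ outside-c , complete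
  ...     | h∈H , a | inj₂ anticomplete = ⊥-elim (anticomplete h (T⇒∈ h∈H) a)

  hasEdgeIn? : ∀ H → Dec (HasEdgeIn G H)
  hasEdgeIn? H = any? λ u → any? λ v → u ∈? H ×-dec v ∈? H ×-dec T? (adj G u v)

  Agree : Fin n → Fin n → Set
  Agree x y = ∀ z → z ≢ x → z ≢ y → adj G x z ≡ adj G y z

  module _ {x y : Fin n} where

    closedNbhd-entries : closedNbhd G x ≡ closedNbhd G y →
                         ∀ z → ⌊ z ≟ x ⌋ ∨ adj G x z ≡ ⌊ z ≟ y ⌋ ∨ adj G y z
    closedNbhd-entries eq z =
      trans (sym (lookup∘tabulate _ z))
            (trans (cong (λ s → lookup s z) eq) (lookup∘tabulate _ z))

    trueTwins⇒adjacent : TrueTwins G x y → Adj G x y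
    trueTwins⇒adjacent (x≢y , eq) = from T-≡ (begin
      adj G x y                 ≡⟨ cong (_∨ adj G x y) (sym (≟-distinct (λ y≡x → x≢y (sym y≡x)))) ⟩
      ⌊ y ≟ x ⌋ ∨ adj G x y     ≡⟨ closedNbhd-entries eq y ⟩
      ⌊ y ≟ y ⌋ ∨ adj G y y     ≡⟨ cong (_∨ adj G y y) (≟-refl y) ⟩
      true                      ∎)
      where open ≡-Reasoning

    trueTwins⇒agree : TrueTwins G x y → Agree x y
    trueTwins⇒agree (_ , eq) z z≢x z≢y = begin
      adj G x z                 ≡⟨ cong (_∨ adj G x z) (sym (≟-distinct z≢x)) ⟩
      ⌊ z ≟ x ⌋ ∨ adj G x z     ≡⟨ closedNbhd-entries eq z ⟩
      ⌊ z ≟ y ⌋ ∨ adj G y z     ≡⟨ cong (_∨ adj G y z) (≟-distinct z≢y) ⟩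
      adj G y z                 ∎
      where open ≡-Reasoning

    trueTwins-intro : x ≢ y → Adj G x y → Agree x y → TrueTwins G x y
    trueTwins-intro x≢y axy agree = x≢y , tabulate-cong entries
      where
      entries : ∀ z → ⌊ z ≟ x ⌋ ∨ adj G x z ≡ ⌊ z ≟ y ⌋ ∨ adj G y z
      entries z with z ≟ x | z ≟ y
      ... | yes refl | yes refl = ⊥-elim (x≢y refl)
      ... | yes refl | no _     = sym (to T-≡ (adj-sym axy))
      ... | no _     | yes refl = to T-≡ axy
      ... | no z≢x   | no z≢y   = agree z z≢x z≢y

    pair : Subset n
    pair = ⁅ x ⁆ ∪ ⁅ y ⁆

    x∈pair : x ∈ pair
    x∈pair = x∈p∪q⁺ (inj₁ (x∈⁅x⁆ x))

    y∈pair : y ∈ pair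
    y∈pair = x∈p∪q⁺ (inj₂ (x∈⁅x⁆ y))

    pair⁻ : ∀ {z} → z ∈ pair → z ≡ x ⊎ z ≡ y
    pair⁻ {z} m with x∈p∪q⁻ ⁅ x ⁆ ⁅ y ⁆ m
    ... | inj₁ z∈⁅x⁆ = inj₁ (x∈⁅y⁆⇒x≡y x z∈⁅x⁆)
    ... | inj₂ z∈⁅y⁆ = inj₂ (x∈⁅y⁆⇒x≡y y z∈⁅y⁆)

    agree-transfer : Agree x y → ∀ {v} → v ∉ pair → Adj G v x ⇔ Adj G v y
    agree-transfer agree {v} v∉pair = mk⇔
      (λ vx → adj-sym (subst T same (adj-sym vx)))
      (λ vy → adj-sym (subst T (sym same) (adj-sym vy)))
      where
      v≢x : v ≢ x
      v≢x refl = v∉pair x∈pair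
      v≢y : v ≢ y
      v≢y refl = v∉pair y∈pair
      same : adj G x v ≡ adj G y v
      same = agree v v≢x v≢y

    agree⇒module : Agree x y → IsModule pair
    agree⇒module agree v v∉pair with T? (adj G v x)
    ... | yes vx = inj₁ λ h h∈pair → sees h (pair⁻ h∈pair)
      where
      sees : ∀ h → h ≡ x ⊎ h ≡ y → Adj G v h
      sees _ (inj₁ refl) = vx
      sees _ (inj₂ refl) = to (agree-transfer agree v∉pair) vx
    ... | no ¬vx = inj₂ λ h h∈pair → blind h (pair⁻ h∈pair)
      where
      blind : ∀ h → h ≡ x ⊎ h ≡ y → ¬ Adj G v h
      blind _ (inj₁ refl)    = ¬vx
      blind _ (inj₂ refl) vy = ¬vx (from (agree-transfer agree v∉pair) vy)

    common∉pair : ∀ {c} → c ∈ nbhd G x ∩ nbhd G y → c ∉ pair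
    common∉pair {c} m c∈pair with x∈p∩q⁻ (nbhd G x) (nbhd G y) m | pair⁻ c∈pair
    ... | xc , _  | inj₁ refl = adj⇒≢ (nbhd⁻ xc) refl
    ... | _  , yc | inj₂ refl = adj⇒≢ (nbhd⁻ yc) refl

    common⊆N-pair : nbhd G x ∩ nbhd G y ⊆ N G pair
    common⊆N-pair m = N⁺ (common∉pair m) x∈pair (adj-sym (nbhd⁻ (proj₁ (x∈p∩q⁻ _ _ m))))

    twins⇒homogeneous-pair :
      TrueTwins G x y → 2 ≤ ∣ nbhd G x ∩ nbhd G y ∣ →
      Adj G x y × Σ (Subset n) λ H′ → Homogeneous G H′ × 2 ≤ ∣ N G H′ ∣ × x ∈ H′ × y ∈ H′
    twins⇒homogeneous-pair twins@(x≢y , _) 2≤common =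
      trueTwins⇒adjacent twins ,
      pair ,
      (two-members⇒2≤∣p∣ x≢y x∈pair y∈pair , pair≢⊤ , agree⇒module (trueTwins⇒agree twins)) ,
      ≤-trans 2≤common (p⊆q⇒∣p∣≤∣q∣ common⊆N-pair) ,
      x∈pair , y∈pair
      where
      pair≢⊤ : pair ≢ ⊤
      pair≢⊤ pair≡⊤ with member _ (≤-trans (s≤s z≤n) 2≤common)
      ... | c , c∈common = common∉pair c∈common (subst (c ∈_) (sym pair≡⊤) ∈⊤)

  unique-neighbour : ∀ {H u v z} → DisjointUnionOfEdges G H →
                     u ∈ H → v ∈ H → z ∈ H → Adj G u v → Adj G u z → z ≡ v
  unique-neighbour matching u∈H v∈H z∈H uv uz with matching _ u∈H
  ... | _ , _ , _ , only = trans (only _ z∈H uz) (sym (only _ v∈H uv))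

module DominatingInducedMatching {n : ℕ} (G : Graph n)
                                 {M : Fin n → Fin n → Bool} (dim : IsDIM G M) where
  open IsDIM dim

  Matched : Fin n → Fin n → Set
  Matched u v = T (M u v)

  Covered : Fin n → Set
  Covered v = ∃ λ w → Matched v w

  matched-sym : ∀ {u v} → Matched u v → Matched v u
  matched-sym {u} {v} = subst T (symM u v)

  covered-endpoint : ∀ {u v} → Adj G u v → Covered u ⊎ Covered v
  covered-endpoint {u} {v} uv with T? (M u v)
  ... | yes uv∈M = inj₁ (v , uv∈M)
  ... | no uv∉M with dominating u v uv uv∉M
  ...   | _ , y , xy , inj₁ refl                 = inj₁ (y , xy)
  ...   | x , _ , xy , inj₂ (inj₁ refl)          = inj₁ (x , matched-sym xy)
  ...   | _ , y , xy , inj₂ (inj₂ (inj₁ refl))   = inj₂ (y , xy)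
  ...   | x , _ , xy , inj₂ (inj₂ (inj₂ refl))   = inj₂ (x , matched-sym xy)

  uncovered-stable : ∀ {u v} → ¬ Covered u → ¬ Covered v → ¬ Adj G u v
  uncovered-stable ¬cu ¬cv uv = [ ¬cu , ¬cv ]′ (covered-endpoint uv)

  partner-unique : ∀ {z w w′} → Matched z w → Matched z w′ → w ≡ w′
  partner-unique {z} {w} {w′} zw zw′ with w ≟ w′
  ... | yes w≡w′ = w≡w′
  ... | no w≢w′  = ⊥-elim (proj₁ (disjoint z w z w′ zw zw′ different) refl)
    where
    different : ¬ SameEdge G z w z w′
    different (inj₁ (_ , w≡w′)) = w≢w′ w≡w′
    different (inj₂ (_ , w≡z))  = adj⇒≢ G (subsetE z w zw) (sym w≡z)

  matched-neighbour-uncovered : ∀ {u v z} → Matched u v → Adj G u z → z ≢ v → ¬ Covered z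
  matched-neighbour-uncovered {u} {v} {z} uv uz z≢v (w , zw) =
    proj₁ (induced u v z w uv zw different) uz
    where
    different : ¬ SameEdge G u v z w
    different (inj₁ (u≡z , _)) = adj⇒≢ G uz u≡z
    different (inj₂ (_ , v≡z)) = z≢v (sym v≡z)

  module AroundModule {H : Subset n} (module-H : IsModule G H) (2≤∣N∣ : 2 ≤ ∣ N G H ∣) where

    outside≢inside : ∀ {c h} → c ∉ H → h ∈ H → c ≢ h
    outside≢inside c∉H h∈H refl = c∉H h∈H

    complete-avoiding : ∀ y → ∃ λ c → c ∉ H × CompleteTo G c H × c ≢ y
    complete-avoiding y with member-avoiding (N G H) 2≤∣N∣ y
    ... | c , c∈N , c≢y with N-of-module G module-H c∈N
    ...   | c∉H , complete = c , c∉H , complete , c≢y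

    -- An M-edge at an end of an edge hh′ of G[H] is hh′ itself: an M-edge
    -- hy with y ≠ h′ would leave h′ and a vertex c ∈ N(H) ∖ {y} uncovered,
    -- although c and h′ are adjacent.
    matched-at-inner-edge : ∀ {h h′ y} → h ∈ H → h′ ∈ H → Adj G h h′ → Matched h y → Matched h h′
    matched-at-inner-edge {h} {h′} {y} h∈H h′∈H hh′ hy with y ≟ h′
    ... | yes refl = hy
    ... | no y≢h′ with complete-avoiding y
    ...   | c , _ , complete , c≢y = ⊥-elim (uncovered-stable
              (matched-neighbour-uncovered hy (adj-sym G (complete h h∈H)) c≢y)
              (matched-neighbour-uncovered hy hh′ (λ h′≡y → y≢h′ (sym h′≡y)))
              (complete h′ h′∈H))

    inner-edge-matched : ∀ {h h′} → h ∈ H → h′ ∈ H → Adj G h h′ → Matched h h′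
    inner-edge-matched h∈H h′∈H hh′ with covered-endpoint hh′
    ... | inj₁ (_ , hy)  = matched-at-inner-edge h∈H h′∈H hh′ hy
    ... | inj₂ (_ , h′y) = matched-sym (matched-at-inner-edge h′∈H h∈H (adj-sym G hh′) h′y)

    complete-uncovered : HasEdgeIn G H → ∀ {c} → c ∉ H → CompleteTo G c H → ¬ Covered c
    complete-uncovered (h , h′ , h∈H , h′∈H , hh′) c∉H complete =
      matched-neighbour-uncovered (inner-edge-matched h∈H h′∈H hh′)
        (adj-sym G (complete h h∈H)) (outside≢inside c∉H h′∈H)

    matched-inside : HasEdgeIn G H → ∀ {z} → z ∈ H → ∃ λ w → w ∈ H × Matched z w
    matched-inside edge {z} z∈H with complete-avoiding z
    ... | a , a∉H , a-complete , _ with covered-endpoint (a-complete z z∈H)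
    ...   | inj₁ a-covered = ⊥-elim (complete-uncovered edge a∉H a-complete a-covered)
    ...   | inj₂ (w , zw) with w ∈? H
    ...     | yes w∈H = w , w∈H , zw
    ...     | no w∉H with module-H w w∉H
    ...       | inj₁ w-complete = ⊥-elim (complete-uncovered edge w∉H w-complete (z , matched-sym zw))
    ...       | inj₂ w-blind    = ⊥-elim (w-blind z z∈H (adj-sym G (subsetE z w zw)))

    disjoint-union-of-edges : HasEdgeIn G H → DisjointUnionOfEdges G H
    disjoint-union-of-edges edge z z∈H with matched-inside edge z∈H
    ... | w , w∈H , zw = w , w∈H , subsetE z w zw ,
          λ w′ w′∈H zw′ → partner-unique (inner-edge-matched z∈H w′∈H zw′) zw

  inner-edge⇒N-stable : ∀ {H} → IsModule G H → HasEdgeIn G H → Stable G (N G H)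
  inner-edge⇒N-stable {H} module-H edge u v u∈N v∈N uv =
    uncovered-stable (uncovered u∈N) (uncovered v∈N) uv
    where
    open AroundModule module-H (two-members⇒2≤∣p∣ (adj⇒≢ G uv) u∈N v∈N)
    uncovered : ∀ {c} → c ∈ N G H → ¬ Covered c
    uncovered c∈N with N-of-module G module-H c∈N
    ... | c∉H , complete = complete-uncovered edge c∉H complete

  N≥2⇒edgeless-or-matching : ∀ {H} → IsModule G H → 2 ≤ ∣ N G H ∣ →
                             Edgeless G H ⊎ DisjointUnionOfEdges G H
  N≥2⇒edgeless-or-matching {H} module-H 2≤∣N∣ with hasEdgeIn? G H
  ... | yes edge = inj₂ (AroundModule.disjoint-union-of-edges module-H 2≤∣N∣ edge)
  ... | no ¬edge = inj₁ λ u v u∈H v∈H uv → ¬edge (u , v , u∈H , v∈H , uv)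

  -- Part (iii), backward direction: by (ii), xy is the only edge of G[H′]
  -- at x and at y, so x and y agree inside H′, and outside H′ because H′ is
  -- a module; N(H′) lies in the common neighbourhood.
  homogeneous-edge⇒twins : ∀ {x y} → Adj G x y →
    (Σ (Subset n) λ H′ → Homogeneous G H′ × 2 ≤ ∣ N G H′ ∣ × x ∈ H′ × y ∈ H′) →
    TrueTwins G x y × 2 ≤ ∣ nbhd G x ∩ nbhd G y ∣
  homogeneous-edge⇒twins {x} {y} xy (H′ , (_ , _ , module-H′) , 2≤∣N∣ , x∈H′ , y∈H′) =
    trueTwins-intro G (adj⇒≢ G xy) xy agree , ≤-trans 2≤∣N∣ (p⊆q⇒∣p∣≤∣q∣ N⊆common)
    where
    matching : DisjointUnionOfEdges G H′
    matching = AroundModule.disjoint-union-of-edges module-H′ 2≤∣N∣ (x , y , x∈H′ , y∈H′ , xy)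

    agree : Agree G x y
    agree z z≢x z≢y with z ∈? H′
    ... | yes z∈H′ =
      T-ext (λ xz → ⊥-elim (z≢y (unique-neighbour G matching x∈H′ y∈H′ z∈H′ xy xz)))
            (λ yz → ⊥-elim (z≢x (unique-neighbour G matching y∈H′ x∈H′ z∈H′ (adj-sym G xy) yz)))
    ... | no z∉H′ with module-H′ z z∉H′
    ...   | inj₁ complete = T-ext (λ _ → adj-sym G (complete y y∈H′)) (λ _ → adj-sym G (complete x x∈H′))
    ...   | inj₂ blind    = T-ext (λ xz → ⊥-elim (blind x x∈H′ (adj-sym G xz)))
                                  (λ yz → ⊥-elim (blind y y∈H′ (adj-sym G yz)))

    N⊆common : N G H′ ⊆ nbhd G x ∩ nbhd G y
    N⊆common c∈N with N-of-module G module-H′ c∈N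
    ... | _ , complete = x∈p∩q⁺ (nbhd⁺ G (adj-sym G (complete x x∈H′)) , nbhd⁺ G (adj-sym G (complete y y∈H′)))

corollary2 : ∀ {n} (G : Graph n) → HasDIM G → (H : Subset n) → Homogeneous G H →
    (HasEdgeIn G H → Stable G (N G H)) ×
    (2 ≤ ∣ N G H ∣ → Edgeless G H ⊎ DisjointUnionOfEdges G H) ×
    (∀ (x y : Fin n) →
      (TrueTwins G x y × 2 ≤ ∣ nbhd G x ∩ nbhd G y ∣) ⇔
      (Adj G x y × Σ (Subset n) λ H′ → Homogeneous G H′ × 2 ≤ ∣ N G H′ ∣ × x ∈ H′ × y ∈ H′))
corollary2 G (_ , dim) H (_ , _ , module-H) =
  inner-edge⇒N-stable module-H ,
  N≥2⇒edgeless-or-matching module-H ,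
  λ x y → mk⇔ (λ (twins , 2≤common) → twins⇒homogeneous-pair G twins 2≤common)
              (λ (xy , homogeneous-pair) → homogeneous-edge⇒twins xy homogeneous-pair)
  where open DominatingInducedMatching G dim
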